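{- Let $N\ge 1$ and $k\ge 1$. Let $Q$ be a set of queens placed on distinct squares of the $N\times N$ chessboard, each colored with one of $k$ colors, such that (i) every square of the board either contains a queen of $Q$ or lies in the same row, column or diagonal as some queen of $Q$, and (ii) for each color, the queens of that color form a connected set in $G(Q)$. Then $|Q|\ge \left\lceil (2N-k-2)/3\right\rceil$.
   Context: Squares are $(x,y)$ with $1\le x,y\le N$. A queen on $(x,y)$ covers every square in column $x$, in row $y$, and on the two diagonals through $(x,y)$; coverage is not blocked by other queens. A "line" means a row, a column, or a diagonal (in either direction). $G(Q)$ is the graph on the queens of $Q$ with an edge between two queens exactly when they lie on a common line and no other queen of $Q$ lies on that line strictly between them. "The queens of a color form a connected set" means that the subgraph of $G(Q)$ induced by those queens is connected. Consequently $G(Q)$ has at most $k$ connected components. -}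

module Defs where

open import Data.Nat using (ℕ; _+_; _<_; _/_)
open import Data.Fin using (Fin; toℕ)
open import Data.Product using (_×_; _,_; proj₁; proj₂; ∃; Σ)
open import Data.Sum using (_⊎_)
open import Relation.Binary.PropositionalEquality using (_≡_; _≢_)
open import Relation.Binary.Construct.Closure.ReflexiveTransitive using (Star)
open import Relation.Nullary using (¬_)

-- Squares of the N×N board; coordinates are 0-based (toℕ), which is
-- just a translation of the paper's 1 ≤ x,y ≤ N.
Square : ℕ → Set
Square N = Fin N × Fin N

col row : ∀ {N} → Square N → ℕ
col s = toℕ (proj₁ s)
row s = toℕ (proj₂ s)

StrictlyBetween : ℕ → ℕ → ℕ → Set
StrictlyBetween a b c = (b < a × a < c) ⊎ (c < a × a < b)

SameCol SameRow SameDiag SameAnti : ∀ {N} → Square N → Square N → Set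
SameCol s t = col s ≡ col t
SameRow s t = row s ≡ row t
SameDiag s t = col s + row t ≡ col t + row s   -- x - y constant
SameAnti s t = col s + row s ≡ col t + row t

OnCommonLine : ∀ {N} → Square N → Square N → Set
OnCommonLine s t = SameCol s t ⊎ SameRow s t ⊎ SameDiag s t ⊎ SameAnti s t

record Queens (N k : ℕ) : Set where
  field
    m     : ℕ
    pos   : Fin m → Square N
    color : Fin m → Fin k

open Queens public

DistinctSquares : ∀ {N k} → Queens N k → Set
DistinctSquares Q = ∀ i j → pos Q i ≡ pos Q j → i ≡ j

Dominating : ∀ {N k} → Queens N k → Set
Dominating {N} Q = ∀ (s : Square N) → ∃ λ i → OnCommonLine (pos Q i) s

BetweenOnCol BetweenOnRow BetweenOnDiag BetweenOnAnti :
  ∀ {N} → Square N → Square N → Square N → Set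
BetweenOnCol r s t = SameCol r s × StrictlyBetween (row r) (row s) (row t)
BetweenOnRow r s t = SameRow r s × StrictlyBetween (col r) (col s) (col t)
BetweenOnDiag r s t = SameDiag r s × StrictlyBetween (col r) (col s) (col t)
BetweenOnAnti r s t = SameAnti r s × StrictlyBetween (col r) (col s) (col t)

Edge : ∀ {N k} (Q : Queens N k) → Fin (m Q) → Fin (m Q) → Set
Edge Q i j = i ≢ j ×
  ( (SameCol s t × (∀ l → ¬ BetweenOnCol (pos Q l) s t))
  ⊎ (SameRow s t × (∀ l → ¬ BetweenOnRow (pos Q l) s t))
  ⊎ (SameDiag s t × (∀ l → ¬ BetweenOnDiag (pos Q l) s t))
  ⊎ (SameAnti s t × (∀ l → ¬ BetweenOnAnti (pos Q l) s t)) )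
  where
  s = pos Q i
  t = pos Q j

InducedEdge : ∀ {N k} (Q : Queens N k) (c : Fin k) → Fin (m Q) → Fin (m Q) → Set
InducedEdge Q c i j = color Q i ≡ c × color Q j ≡ c × Edge Q i j

ColorConnected : ∀ {N k} (Q : Queens N k) → Fin k → Set
ColorConnected Q c = ∀ i j → color Q i ≡ c → color Q j ≡ c →
  Star (InducedEdge Q c) i j

⌈_/3⌉ : ℕ → ℕ
⌈ n /3⌉ = (n + 2) / 3

module Submission where

-- Let W be the set of lines (rows, columns, diagonals, antidiagonals) through the queens.
-- Visit the queens one at a time: the next one either has a colour not met before, adding at
-- most 4 lines to W, or, its colour class being connected, can be chosen adjacent to a visited
-- queen, sharing a line with it and adding at most 3.  Hence |W| ≤ 3|Q| + k.
-- If every row or every column holds a queen, then N ≤ |Q|.  Otherwise the extreme free rows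
-- and columns bound a rectangle.  Each of the 4N points where a row or a column meets its
-- boundary lies on an occupied row or column, or else is a free square and so lies on a
-- diagonal of W; a diagonal meets each of two halves of the boundary at most once.  This gives
-- 4N ≤ 2|W| + 4, the 4 accounting for the corners.  Either way 2N ≤ 3|Q| + k + 2.

open import Data.Bool using (Bool; true; false)
open import Data.Empty using (⊥-elim)
open import Data.Fin using (Fin; zero; suc; toℕ)
import Data.Fin as Fin
open import Data.Fin.Properties using (all?; any?; ¬∀⟶∃¬; injective⇒≤; toℕ<n; toℕ-injective)
  renaming (_≟_ to _≟ᶠ_; ≤∧≢⇒< to ≤∧≢⇒<ᶠ)
open import Data.List using (List; []; _∷_; length; filter; _++_; map; allFin; cartesianProduct)
open import Data.List.Properties
  using (length-++; length-map; length-tabulate; length-filter; filter-notAll; length-removeAt′)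
open import Data.List.Membership.Propositional using (_∈_; _∉_; lose)
import Data.List.Membership.DecPropositional as ∈-Dec
open import Data.List.Membership.Propositional.Properties
  using (∈-allFin; ∈-filter⁺; ∈-++⁺ˡ; ∈-++⁺ʳ; ∈-map⁺; ∈-map⁻; ∈-cartesianProduct⁺)
open import Data.List.Relation.Binary.Subset.Propositional using (_⊆_)
import Data.List.Relation.Unary.All as All
open import Data.List.Relation.Unary.All using ([]; _∷_)
open import Data.List.Relation.Unary.All.Properties using (¬Any⇒All¬)
open import Data.List.Relation.Unary.Any using (here; there; _─_)
open import Data.List.Relation.Unary.Unique.Propositional using (Unique; []; _∷_)
import Data.List.Relation.Unary.Unique.Propositional.Properties as Unique
open import Data.Nat using (ℕ; zero; suc; _+_; _*_; _∸_; _≤_; _<_; _≥_; _≟_; z≤n; s≤s; s≤s⁻¹)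
open import Data.Nat.DivMod using (m<n*o⇒m/o<n)
open import Data.Nat.Properties
open import Algebra.Properties.CommutativeSemigroup +-commutativeSemigroup using (x∙yz≈y∙xz)
open import Data.Nat.Tactic.RingSolver using (solve-∀)
open import Data.Product using (∃; ∃₂; _×_; _,_; proj₁; proj₂)
open import Data.Sum using (_⊎_; inj₁; inj₂; [_,_]′)
import Data.Sum as Sum
open import Data.Sum.Properties using (≡-dec)
open import Function using (id; _∘_)
open import Relation.Binary.Definitions using (DecidableEquality)
open import Relation.Binary.Construct.Closure.ReflexiveTransitive as Star using (Star; ε; _◅_)
open import Relation.Binary.PropositionalEquality
open import Relation.Nullary using (¬_; ¬?; Dec; yes; no)
open import Relation.Nullary.Decidable using (decidable-stable)
open import Relation.Unary using (Decidable)

open import Defs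

∈-─ : ∀ {A : Set} {x y : A} {xs} (x∈xs : x ∈ xs) → y ∈ xs → y ≢ x → y ∈ (xs ─ x∈xs)
∈-─ (here refl) (here refl) y≢x = ⊥-elim (y≢x refl)
∈-─ (here _) (there y∈xs) _ = y∈xs
∈-─ (there _) (here refl) _ = here refl
∈-─ (there x∈xs) (there y∈xs) y≢x = there (∈-─ x∈xs y∈xs y≢x)

unique⊆⇒length≤ : ∀ {A : Set} {xs ys : List A} → Unique xs → xs ⊆ ys → length xs ≤ length ys
unique⊆⇒length≤ [] _ = z≤n
unique⊆⇒length≤ {xs = x ∷ xs} {ys} (x∉xs ∷ xs!) x∷xs⊆ys = begin
  suc (length xs)          ≤⟨ s≤s (unique⊆⇒length≤ xs! xs⊆ys─x) ⟩
  suc (length (ys ─ x∈ys)) ≡⟨ length-removeAt′ ys _ ⟨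
  length ys                ∎
  where
  open ≤-Reasoning
  x∈ys = x∷xs⊆ys (here refl)
  xs⊆ys─x : xs ⊆ (ys ─ x∈ys)
  xs⊆ys─x y∈xs = ∈-─ x∈ys (x∷xs⊆ys (there y∈xs)) (λ y≡x → All.lookup x∉xs y∈xs (sym y≡x))

injective-relation⇒length≤ : ∀ {A B : Set} {R : A → B → Set} {xs : List A} {ys : List B} → Unique xs →
  (∀ a → ∃ λ b → b ∈ ys × R a b) → (∀ {a a' b} → R a b → R a' b → a ≡ a') → length xs ≤ length ys
injective-relation⇒length≤ {R = R} {xs} {ys} xs! total R-injective = begin
  length xs         ≡⟨ length-map f xs ⟨
  length (map f xs) ≤⟨ unique⊆⇒length≤ (Unique.map⁺ f-injective xs!) f[xs]⊆ys ⟩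
  length ys         ∎
  where
  open ≤-Reasoning
  f = λ a → proj₁ (total a)
  f-injective : ∀ {a a'} → f a ≡ f a' → a ≡ a'
  f-injective {a} {a'} eq = R-injective (subst (R a) eq (proj₂ (proj₂ (total a)))) (proj₂ (proj₂ (total a')))
  f[xs]⊆ys : map f xs ⊆ ys
  f[xs]⊆ys b∈ with ∈-map⁻ f b∈
  ... | a , _ , refl = proj₁ (proj₂ (total a))

length-cartesianProduct : ∀ {A B : Set} (xs : List A) (ys : List B) →
  length (cartesianProduct xs ys) ≡ length xs * length ys
length-cartesianProduct []       ys = refl
length-cartesianProduct (x ∷ xs) ys = trans (length-++ (map (x ,_) ys))
  (cong₂ _+_ (length-map (x ,_) ys) (length-cartesianProduct xs ys))

_∈ᶠ?_ : ∀ {n} (v : Fin n) (xs : List (Fin n)) → Dec (v ∈ xs)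
_∈ᶠ?_ = ∈-Dec._∈?_ _≟ᶠ_

module _ {n : ℕ} where

  length-allFin : length (allFin n) ≡ n
  length-allFin = length-tabulate id

  unique⇒length≤ : {xs : List (Fin n)} → Unique xs → length xs ≤ n
  unique⇒length≤ {xs} xs! = subst (length xs ≤_) length-allFin (unique⊆⇒length≤ xs! (λ {x} _ → ∈-allFin x))

  short⇒∃∉ : (xs : List (Fin n)) → length xs < n → ∃ λ v → v ∉ xs
  short⇒∃∉ xs short with all? (λ v → v ∈ᶠ? xs)
  ... | yes all∈ = ⊥-elim (<⇒≱ short (subst (_≤ length xs) length-allFin
                     (unique⊆⇒length≤ (Unique.allFin⁺ n) (λ {v} _ → all∈ v))))
  ... | no ¬all∈ = ¬∀⟶∃¬ n _ (λ v → v ∈ᶠ? xs) ¬all∈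

  unique-full⇒∈ : {xs : List (Fin n)} → Unique xs → length xs ≡ n → ∀ v → v ∈ xs
  unique-full⇒∈ {xs} xs! full v with v ∈ᶠ? xs
  ... | yes v∈xs = v∈xs
  ... | no v∉xs = ⊥-elim (1+n≰n (subst (λ l → suc l ≤ n) full (unique⇒length≤ (¬Any⇒All¬ xs v∉xs ∷ xs!))))

surjective⇒≥ : ∀ {m n} (f : Fin m → Fin n) → (∀ y → ∃ λ x → f x ≡ y) → m ≥ n
surjective⇒≥ f onto = injective⇒≤ {f = λ y → proj₁ (onto y)}
  (λ {y} {y'} eq → trans (sym (proj₂ (onto y))) (trans (cong f eq) (proj₂ (onto y'))))

exit-edge : ∀ {A : Set} {R : A → A → Set} {P : A → Set} → Decidable P → ∀ {i j} →
  Star R i j → P i → ¬ P j → ∃₂ λ u v → P u × ¬ P v × R u v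
exit-edge P? ε Pi ¬Pi = ⊥-elim (¬Pi Pi)
exit-edge P? (_◅_ {j = v} uv vj) Pu ¬Pj with P? v
... | yes Pv = exit-edge P? vj Pv ¬Pj
... | no ¬Pv = _ , v , Pu , ¬Pv , uv

least : ∀ {n} {P : Fin n → Set} → Decidable P → (∀ y → ¬ P y) ⊎ ∃ λ lo → P lo × ∀ y → P y → lo Fin.≤ y
least {zero} P? = inj₁ λ ()
least {suc n} P? with P? zero | least (λ y → P? (suc y))
... | yes P0 | _ = inj₂ (zero , P0 , λ _ _ → z≤n)
... | no ¬P0 | inj₁ none = inj₁ λ { zero → ¬P0 ; (suc y) → none y }
... | no ¬P0 | inj₂ (lo , Plo , lo≤) =
  inj₂ (suc lo , Plo , λ { zero P0 → ⊥-elim (¬P0 P0) ; (suc y) Py → s≤s (lo≤ y Py) })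

greatest : ∀ {n} {P : Fin n → Set} → Decidable P → (∀ y → ¬ P y) ⊎ ∃ λ hi → P hi × ∀ y → P y → y Fin.≤ hi
greatest {zero} P? = inj₁ λ ()
greatest {suc n} P? with greatest (λ y → P? (suc y)) | P? zero
... | inj₂ (hi , Phi , ≤hi) | _ = inj₂ (suc hi , Phi , λ { zero _ → z≤n ; (suc y) Py → s≤s (≤hi y Py) })
... | inj₁ none | yes P0 = inj₂ (zero , P0 , λ { zero _ → z≤n ; (suc y) Py → ⊥-elim (none y Py) })
... | inj₁ none | no ¬P0 = inj₁ λ { zero → ¬P0 ; (suc y) → none y }

extrema : ∀ {n} {P : Fin n → Set} → Decidable P →
  (∀ y → ¬ P y) ⊎ ∃₂ λ lo hi → P lo × P hi × ∀ y → P y → lo Fin.≤ y × y Fin.≤ hi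
extrema P? with least P? | greatest P?
... | inj₁ none | _ = inj₁ none
... | inj₂ (lo , Plo , _) | inj₁ none = ⊥-elim (none lo Plo)
... | inj₂ (lo , Plo , lo≤) | inj₂ (hi , Phi , ≤hi) =
  inj₂ (lo , hi , Plo , Phi , λ y Py → lo≤ y Py , ≤hi y Py)

module GreedyCover {M k d : ℕ} {L : Set} (_≟ᴸ_ : DecidableEquality L)
  (E : Fin M → Fin M → Set) (colour : Fin M → Fin k) (lines : Fin M → List L)
  (few-lines : ∀ v → length (lines v) ≤ suc d)
  (edge-shares-line : ∀ {u v} → E u v → ∃ λ ℓ → ℓ ∈ lines u × ℓ ∈ lines v)
  (same-colour-joined : ∀ i j → colour i ≡ colour j → Star E i j)
  where

  open ∈-Dec _≟ᴸ_ using (_∈?_; _∉?_)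

  new-lines : Fin M → List L → List L
  new-lines v W = filter (λ ℓ → ℓ ∉? W) (lines v)

  lines⊆new-lines++ : ∀ v W → lines v ⊆ new-lines v W ++ W
  lines⊆new-lines++ v W {ℓ} ℓ∈ with ℓ ∈? W
  ... | yes ℓ∈W = ∈-++⁺ʳ _ ℓ∈W
  ... | no ℓ∉W = ∈-++⁺ˡ (∈-filter⁺ (λ ℓ → ℓ ∉? W) ℓ∈ ℓ∉W)

  length-new-lines : ∀ v W → length (new-lines v W) ≤ suc d
  length-new-lines v W = ≤-trans (length-filter _ (lines v)) (few-lines v)

  length-new-lines-shared : ∀ {v W ℓ} → ℓ ∈ lines v → ℓ ∈ W → length (new-lines v W) ≤ d
  length-new-lines-shared {v} {W} ℓ∈ ℓ∈W = s≤s⁻¹ (≤-trans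
    (filter-notAll (λ ℓ → ℓ ∉? W) (lines v) (lose ℓ∈ (λ ℓ∉W → ℓ∉W ℓ∈W))) (few-lines v))

  record Exploration (n : ℕ) : Set where
    field
      visited         : List (Fin M)
      visited-unique  : Unique visited
      visited-length  : length visited ≡ n
      covered         : List L
      covers          : ∀ {v} → v ∈ visited → lines v ⊆ covered
      colours         : List (Fin k)
      colours-unique  : Unique colours
      colours-visited : ∀ {c} → c ∈ colours → ∃ λ v → v ∈ visited × colour v ≡ c
      covered-length  : length covered ≤ d * n + length colours

  open Exploration

  visit : ∀ {n} (e : Exploration n) {v} → v ∉ visited e →
    (cs : List (Fin k)) → Unique cs → (∀ {c} → c ∈ cs → c ∈ colours e ⊎ colour v ≡ c) →
    length (new-lines v (covered e)) + length (colours e) ≤ d + length cs → Exploration (suc n)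
  visit {n} e {v} v∉ cs cs! cs⊆ cost = record
    { visited         = v ∷ visited e
    ; visited-unique  = ¬Any⇒All¬ _ v∉ ∷ visited-unique e
    ; visited-length  = cong suc (visited-length e)
    ; covered         = new ++ covered e
    ; covers          = λ { (here refl) → lines⊆new-lines++ v (covered e)
                          ; (there u∈) ℓ∈ → ∈-++⁺ʳ new (covers e u∈ ℓ∈) }
    ; colours         = cs
    ; colours-unique  = cs!
    ; colours-visited = λ c∈ → [ (λ c∈′ → let u , u∈ , cu = colours-visited e c∈′ in u , there u∈ , cu)
                                , (λ cv → v , here refl , cv) ]′ (cs⊆ c∈)
    ; covered-length  = begin
        length (new ++ covered e)                 ≡⟨ length-++ new ⟩
        length new + length (covered e)           ≤⟨ +-monoʳ-≤ (length new) (covered-length e) ⟩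
        length new + (d * n + length (colours e)) ≡⟨ x∙yz≈y∙xz (length new) (d * n) _ ⟩
        d * n + (length new + length (colours e)) ≤⟨ +-monoʳ-≤ (d * n) cost ⟩
        d * n + (d + length cs)                   ≡⟨ x∙yz≈y∙xz (d * n) d _ ⟩
        d + (d * n + length cs)                   ≡⟨ +-assoc d (d * n) _ ⟨
        d + d * n + length cs                     ≡⟨ cong (_+ length cs) (*-suc d n) ⟨
        d * suc n + length cs                     ∎
    }
    where
    open ≤-Reasoning
    new = new-lines v (covered e)

  step : ∀ {n} → Exploration n → n < M → Exploration (suc n)
  step e n<M with short⇒∃∉ (visited e) (subst (_< M) (sym (visited-length e)) n<M)
  ... | j , j∉ with colour j ∈ᶠ? colours e
  ...   | no new-colour = visit e j∉ (colour j ∷ colours e) (¬Any⇒All¬ _ new-colour ∷ colours-unique e)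
            (λ { (here refl) → inj₂ refl ; (there c∈) → inj₁ c∈ })
            (≤-trans (+-monoˡ-≤ _ (length-new-lines j (covered e))) (≤-reflexive (sym (+-suc d _))))
  ...   | yes old-colour with colours-visited e old-colour
  ...     | i , i∈ , ci with exit-edge (_∈ᶠ? visited e) (same-colour-joined i j ci) i∈ j∉
  ...       | u , v , u∈ , v∉ , uv with edge-shares-line uv
  ...         | ℓ , ℓ∈u , ℓ∈v = visit e v∉ (colours e) (colours-unique e) inj₁
                  (+-monoˡ-≤ _ (length-new-lines-shared ℓ∈v (covers e u∈ ℓ∈u)))

  explore : ∀ n → n ≤ M → Exploration n
  explore zero _ = record
    { visited = [] ; visited-unique = [] ; visited-length = refl ; covered = [] ; covers = λ ()
    ; colours = [] ; colours-unique = [] ; colours-visited = λ () ; covered-length = z≤n }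
  explore (suc n) n<M = step (explore n (<⇒≤ n<M)) n<M

  lines-cover : ∃ λ W → (∀ v → lines v ⊆ W) × length W ≤ d * M + k
  lines-cover = covered e , (λ v → covers e (unique-full⇒∈ (visited-unique e) (visited-length e) v)) ,
    ≤-trans (covered-length e) (+-monoʳ-≤ (d * M) (unique⇒length≤ (colours-unique e)))
    where e = explore M ≤-refl

Line : Set
Line = ℕ ⊎ ℕ ⊎ ℕ ⊎ ℕ

colL rowL diagL antiL : ℕ → Line
colL  = inj₁
rowL  = inj₂ ∘ inj₁
diagL = inj₂ ∘ inj₂ ∘ inj₁
antiL = inj₂ ∘ inj₂ ∘ inj₂

_≟ᴸ_ : DecidableEquality Line
_≟ᴸ_ = ≡-dec _≟_ (≡-dec _≟_ (≡-dec _≟_ _≟_))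

diagL-injective : ∀ {d d′} → diagL d ≡ diagL d′ → d ≡ d′
diagL-injective refl = refl

antiL-injective : ∀ {a a′} → antiL a ≡ antiL a′ → a ≡ a′
antiL-injective refl = refl

module _ {N : ℕ} where

  -- x − y, shifted by N to stay in ℕ
  diagonal antidiagonal : Square N → ℕ
  diagonal s     = col s + (N ∸ row s)
  antidiagonal s = col s + row s

  linesThrough : Square N → List Line
  linesThrough s = colL (col s) ∷ rowL (row s) ∷ diagL (diagonal s) ∷ antiL (antidiagonal s) ∷ []

  diagonal-shift : ∀ (s t : Square N) → diagonal s + (row s + row t) ≡ col s + row t + N
  diagonal-shift s t = begin
    col s + (N ∸ row s) + (row s + row t) ≡⟨ regroup (col s) (N ∸ row s) (row s) (row t) ⟩
    col s + row t + (N ∸ row s + row s)   ≡⟨ cong (col s + row t +_) (m∸n+n≡m (<⇒≤ (toℕ<n (proj₂ s)))) ⟩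
    col s + row t + N                     ∎
    where
    open ≡-Reasoning
    regroup : ∀ a b c d → a + b + (c + d) ≡ a + d + (b + c)
    regroup = solve-∀

  SameDiag⇒diagonal≡ : ∀ {s t : Square N} → SameDiag s t → diagonal s ≡ diagonal t
  SameDiag⇒diagonal≡ {s} {t} same = +-cancelʳ-≡ (row s + row t) _ _ (begin
    diagonal s + (row s + row t) ≡⟨ diagonal-shift s t ⟩
    col s + row t + N            ≡⟨ cong (_+ N) same ⟩
    col t + row s + N            ≡⟨ diagonal-shift t s ⟨
    diagonal t + (row t + row s) ≡⟨ cong (diagonal t +_) (+-comm (row t) (row s)) ⟩
    diagonal t + (row s + row t) ∎)
    where open ≡-Reasoning

  diagonal≡⇒SameDiag : ∀ {s t : Square N} → diagonal s ≡ diagonal t → SameDiag s t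
  diagonal≡⇒SameDiag {s} {t} same = +-cancelʳ-≡ N _ _ (begin
    col s + row t + N            ≡⟨ diagonal-shift s t ⟨
    diagonal s + (row s + row t) ≡⟨ cong₂ _+_ same (+-comm (row s) (row t)) ⟩
    diagonal t + (row t + row s) ≡⟨ diagonal-shift t s ⟩
    col t + row s + N            ∎)
    where open ≡-Reasoning

  common-line : ∀ {s t : Square N} → OnCommonLine s t → ∃ λ ℓ → ℓ ∈ linesThrough s × ℓ ∈ linesThrough t
  common-line (inj₁ same) = _ , here refl , here (cong colL same)
  common-line (inj₂ (inj₁ same)) = _ , there (here refl) , there (here (cong rowL same))
  common-line {s} {t} (inj₂ (inj₂ (inj₁ same))) = _ , there (there (here refl)) ,
    there (there (here (cong diagL (SameDiag⇒diagonal≡ {s = s} {t = t} same))))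
  common-line (inj₂ (inj₂ (inj₂ same))) =
    _ , there (there (there (here refl))) , there (there (there (here (cong antiL same))))

edge-on-common-line : ∀ {N k} {Q : Queens N k} {i j} → Edge Q i j → OnCommonLine (pos Q i) (pos Q j)
edge-on-common-line (_ , edge) = Sum.map proj₁ (Sum.map proj₁ (Sum.map proj₁ proj₁)) edge

data Side : Set where
  left right bottom top : Side

sideLine : Side → ℕ → Line
sideLine left   a = rowL a
sideLine right  a = rowL a
sideLine bottom a = colL a
sideLine top    a = colL a

sideLine-not-diagonal : ∀ f {a d} → sideLine f a ≢ diagL d × sideLine f a ≢ antiL d
sideLine-not-diagonal left   = (λ ()) , (λ ())
sideLine-not-diagonal right  = (λ ()) , (λ ())
sideLine-not-diagonal bottom = (λ ()) , (λ ())
sideLine-not-diagonal top    = (λ ()) , (λ ())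

-- A diagonal meets each of the halves {left, bottom} and {right, top} of the boundary of a
-- rectangle at most once; for an antidiagonal the halves are {left, top} and {right, bottom}.
diagonalHalf antidiagonalHalf : Side → Bool
diagonalHalf left   = true
diagonalHalf bottom = true
diagonalHalf right  = false
diagonalHalf top    = false
antidiagonalHalf left   = true
antidiagonalHalf top    = true
antidiagonalHalf right  = false
antidiagonalHalf bottom = false

sideLine-injective : ∀ f f′ {a a′} → sideLine f a ≡ sideLine f′ a′ → diagonalHalf f ≡ diagonalHalf f′ →
  f ≡ f′ × a ≡ a′
sideLine-injective left   left   refl _ = refl , refl
sideLine-injective right  right  refl _ = refl , refl
sideLine-injective bottom bottom refl _ = refl , refl
sideLine-injective top    top    refl _ = refl , refl
sideLine-injective left   right  _ ()
sideLine-injective right  left   _ ()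
sideLine-injective bottom top    _ ()
sideLine-injective top    bottom _ ()
sideLine-injective left   bottom () _
sideLine-injective left   top    () _
sideLine-injective right  bottom () _
sideLine-injective right  top    () _
sideLine-injective bottom left   () _
sideLine-injective bottom right  () _
sideLine-injective top    left   () _
sideLine-injective top    right  () _

module Board {N k : ℕ} (Q : Queens N k) (dominating : Dominating Q)
  (W : List Line) (covers : ∀ i → linesThrough (pos Q i) ⊆ W) where

  ColOccupied RowOccupied : Fin N → Set
  ColOccupied x = ∃ λ i → proj₁ (pos Q i) ≡ x
  RowOccupied y = ∃ λ i → proj₂ (pos Q i) ≡ y

  colOccupied? : Decidable ColOccupied
  colOccupied? x = any? (λ i → proj₁ (pos Q i) ≟ᶠ x)

  rowOccupied? : Decidable RowOccupied
  rowOccupied? y = any? (λ i → proj₂ (pos Q i) ≟ᶠ y)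

  free-square-on-diagonal : ∀ {x y} → ¬ ColOccupied x → ¬ RowOccupied y →
    diagL (diagonal (x , y)) ∈ W ⊎ antiL (antidiagonal (x , y)) ∈ W
  free-square-on-diagonal {x} {y} x-free y-free with dominating (x , y)
  ... | i , inj₁ same = ⊥-elim (x-free (i , toℕ-injective same))
  ... | i , inj₂ (inj₁ same) = ⊥-elim (y-free (i , toℕ-injective same))
  ... | i , inj₂ (inj₂ (inj₁ same)) = inj₁ (subst (λ d → diagL d ∈ W)
          (SameDiag⇒diagonal≡ {s = pos Q i} {t = x , y} same) (covers i (there (there (here refl)))))
  ... | i , inj₂ (inj₂ (inj₂ same)) = inj₂ (subst (λ a → antiL a ∈ W)
          same (covers i (there (there (there (here refl))))))

  -- The token (f , z) stands for the point where row z (f = left, right) or column z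
  -- (f = bottom, top) meets side f.  It hits its own line, tagged by diagonalHalf f to tell the
  -- two sides apart, if that line is occupied; otherwise the point is a free square and the token
  -- hits a diagonal of W through it, tagged by the half of the boundary it lies in.  The four
  -- column tokens at the corners, whose points are already row points, hit themselves.
  module Rectangle (u₁ u₂ v₁ v₂ : Fin N)
    (u₁-free : ¬ RowOccupied u₁) (u₂-free : ¬ RowOccupied u₂)
    (v₁-free : ¬ ColOccupied v₁) (v₂-free : ¬ ColOccupied v₂)
    (free-rows-between : ∀ y → ¬ RowOccupied y → u₁ Fin.≤ y × y Fin.≤ u₂)
    (free-cols-between : ∀ x → ¬ ColOccupied x → v₁ Fin.≤ x × x Fin.≤ v₂) where

    point : Side → Fin N → Square N
    point left   z = v₁ , z
    point right  z = v₂ , z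
    point bottom z = z , u₁
    point top    z = z , u₂

    OnBoundary : Side → Fin N → Set
    OnBoundary left   z = u₁ Fin.≤ z × z Fin.≤ u₂
    OnBoundary right  z = u₁ Fin.≤ z × z Fin.≤ u₂
    OnBoundary bottom z = v₁ Fin.< z × z Fin.< v₂
    OnBoundary top    z = v₁ Fin.< z × z Fin.< v₂

    diagonal-meets-half-once : ∀ f f′ {z z′} → OnBoundary f z → OnBoundary f′ z′ →
      diagonalHalf f ≡ diagonalHalf f′ → SameDiag (point f z) (point f′ z′) → f ≡ f′ × toℕ z ≡ toℕ z′
    diagonal-meets-half-once left   left   _ _ _ same = refl , sym (+-cancelˡ-≡ (toℕ v₁) _ _ same)
    diagonal-meets-half-once right  right  _ _ _ same = refl , sym (+-cancelˡ-≡ (toℕ v₂) _ _ same)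
    diagonal-meets-half-once bottom bottom _ _ _ same = refl , +-cancelʳ-≡ (toℕ u₁) _ _ same
    diagonal-meets-half-once top    top    _ _ _ same = refl , +-cancelʳ-≡ (toℕ u₂) _ _ same
    diagonal-meets-half-once left   bottom (u₁≤z , _) (v₁<z′ , _) _ same = ⊥-elim (<⇒≢ (+-mono-<-≤ v₁<z′ u₁≤z) same)
    diagonal-meets-half-once bottom left   (v₁<z , _) (u₁≤z′ , _) _ same = ⊥-elim (<⇒≢ (+-mono-<-≤ v₁<z u₁≤z′) (sym same))
    diagonal-meets-half-once right  top    (_ , z≤u₂) (_ , z′<v₂) _ same = ⊥-elim (<⇒≢ (+-mono-<-≤ z′<v₂ z≤u₂) (sym same))
    diagonal-meets-half-once top    right  (_ , z<v₂) (_ , z′≤u₂) _ same = ⊥-elim (<⇒≢ (+-mono-<-≤ z<v₂ z′≤u₂) same)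
    diagonal-meets-half-once left   right  _ _ () _
    diagonal-meets-half-once left   top    _ _ () _
    diagonal-meets-half-once bottom right  _ _ () _
    diagonal-meets-half-once bottom top    _ _ () _
    diagonal-meets-half-once right  left   _ _ () _
    diagonal-meets-half-once right  bottom _ _ () _
    diagonal-meets-half-once top    left   _ _ () _
    diagonal-meets-half-once top    bottom _ _ () _

    antidiagonal-meets-half-once : ∀ f f′ {z z′} → OnBoundary f z → OnBoundary f′ z′ →
      antidiagonalHalf f ≡ antidiagonalHalf f′ → SameAnti (point f z) (point f′ z′) → f ≡ f′ × toℕ z ≡ toℕ z′
    antidiagonal-meets-half-once left   left   _ _ _ same = refl , +-cancelˡ-≡ (toℕ v₁) _ _ same
    antidiagonal-meets-half-once right  right  _ _ _ same = refl , +-cancelˡ-≡ (toℕ v₂) _ _ same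
    antidiagonal-meets-half-once bottom bottom _ _ _ same = refl , +-cancelʳ-≡ (toℕ u₁) _ _ same
    antidiagonal-meets-half-once top    top    _ _ _ same = refl , +-cancelʳ-≡ (toℕ u₂) _ _ same
    antidiagonal-meets-half-once left   top    (_ , z≤u₂) (v₁<z′ , _) _ same = ⊥-elim (<⇒≢ (+-mono-<-≤ v₁<z′ z≤u₂) same)
    antidiagonal-meets-half-once top    left   (v₁<z , _) (_ , z′≤u₂) _ same = ⊥-elim (<⇒≢ (+-mono-<-≤ v₁<z z′≤u₂) (sym same))
    antidiagonal-meets-half-once right  bottom (u₁≤z , _) (_ , z′<v₂) _ same = ⊥-elim (<⇒≢ (+-mono-<-≤ z′<v₂ u₁≤z) (sym same))
    antidiagonal-meets-half-once bottom right  (_ , z<v₂) (u₁≤z′ , _) _ same = ⊥-elim (<⇒≢ (+-mono-<-≤ z<v₂ u₁≤z′) same)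
    antidiagonal-meets-half-once left   right  _ _ () _
    antidiagonal-meets-half-once left   bottom _ _ () _
    antidiagonal-meets-half-once top    right  _ _ () _
    antidiagonal-meets-half-once top    bottom _ _ () _
    antidiagonal-meets-half-once right  left   _ _ () _
    antidiagonal-meets-half-once right  top    _ _ () _
    antidiagonal-meets-half-once bottom left   _ _ () _
    antidiagonal-meets-half-once bottom top    _ _ () _

    Target : Set
    Target = (Line × Bool) ⊎ (Side × Fin N)

    Hits : Side × Fin N → Target → Set
    Hits t (inj₂ t′) = t ≡ t′
    Hits (f , z) (inj₁ (ℓ , b)) =
        (ℓ ≡ sideLine f (toℕ z) × b ≡ diagonalHalf f)
      ⊎ OnBoundary f z × (ℓ ≡ diagL (diagonal (point f z)) × b ≡ diagonalHalf f
                        ⊎ ℓ ≡ antiL (antidiagonal (point f z)) × b ≡ antidiagonalHalf f)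

    bools : List Bool
    bools = true ∷ false ∷ []

    corners : List (Side × Fin N)
    corners = cartesianProduct (bottom ∷ top ∷ []) (v₁ ∷ v₂ ∷ [])

    targets : List Target
    targets = map inj₁ (cartesianProduct W bools) ++ map inj₂ corners

    line-target : ∀ {ℓ} → ℓ ∈ W → ∀ b → inj₁ (ℓ , b) ∈ targets
    line-target ℓ∈ b = ∈-++⁺ˡ (∈-map⁺ inj₁ (∈-cartesianProduct⁺ ℓ∈ (bool∈ b)))
      where
      bool∈ : ∀ b → b ∈ bools
      bool∈ true  = here refl
      bool∈ false = there (here refl)

    Hit : Side × Fin N → Set
    Hit t = ∃ λ e → e ∈ targets × Hits t e

    along : ∀ f z → sideLine f (toℕ z) ∈ W → Hit (f , z)
    along f z ℓ∈ = _ , line-target ℓ∈ (diagonalHalf f) , inj₁ (refl , refl)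

    across : ∀ f z → OnBoundary f z →
      ¬ ColOccupied (proj₁ (point f z)) → ¬ RowOccupied (proj₂ (point f z)) → Hit (f , z)
    across f z on col-free row-free with free-square-on-diagonal col-free row-free
    ... | inj₁ diag∈ = _ , line-target diag∈ (diagonalHalf f) , inj₂ (on , inj₁ (refl , refl))
    ... | inj₂ anti∈ = _ , line-target anti∈ (antidiagonalHalf f) , inj₂ (on , inj₂ (refl , refl))

    corner : ∀ {f z} → f ∈ bottom ∷ top ∷ [] → z ∈ v₁ ∷ v₂ ∷ [] → Hit (f , z)
    corner f∈ z∈ = _ , ∈-++⁺ʳ _ (∈-map⁺ inj₂ (∈-cartesianProduct⁺ f∈ z∈)) , refl

    strictly-between : ∀ z → ¬ ColOccupied z → z ≢ v₁ → z ≢ v₂ → v₁ Fin.< z × z Fin.< v₂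
    strictly-between z free z≢v₁ z≢v₂ =
      ≤∧≢⇒<ᶠ (proj₁ (free-cols-between z free)) (z≢v₁ ∘ sym) , ≤∧≢⇒<ᶠ (proj₂ (free-cols-between z free)) z≢v₂

    hit : ∀ t → Hit t
    hit (left , z) with rowOccupied? z
    ... | yes (i , refl) = along left z (covers i (there (here refl)))
    ... | no free        = across left z (free-rows-between z free) v₁-free free
    hit (right , z) with rowOccupied? z
    ... | yes (i , refl) = along right z (covers i (there (here refl)))
    ... | no free        = across right z (free-rows-between z free) v₂-free free
    hit (bottom , z) with z ≟ᶠ v₁ | z ≟ᶠ v₂ | colOccupied? z
    ... | yes refl | _        | _              = corner (here refl) (here refl)
    ... | no _     | yes refl | _              = corner (here refl) (there (here refl))
    ... | no _     | no _     | yes (i , refl) = along bottom z (covers i (here refl))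
    ... | no z≢v₁  | no z≢v₂  | no free        =
      across bottom z (strictly-between z free z≢v₁ z≢v₂) free u₁-free
    hit (top , z) with z ≟ᶠ v₁ | z ≟ᶠ v₂ | colOccupied? z
    ... | yes refl | _        | _              = corner (there (here refl)) (here refl)
    ... | no _     | yes refl | _              = corner (there (here refl)) (there (here refl))
    ... | no _     | no _     | yes (i , refl) = along top z (covers i (here refl))
    ... | no z≢v₁  | no z≢v₂  | no free        =
      across top z (strictly-between z free z≢v₁ z≢v₂) free u₂-free

    same-token : ∀ {f f′ : Side} {z z′ : Fin N} → f ≡ f′ × toℕ z ≡ toℕ z′ → (f , z) ≡ (f′ , z′)
    same-token (refl , same) = cong (_ ,_) (toℕ-injective same)

    hits-injective : ∀ {t t′ e} → Hits t e → Hits t′ e → t ≡ t′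
    hits-injective {e = inj₂ _} refl refl = refl
    hits-injective {f , _} {f′ , _} {inj₁ _} (inj₁ (refl , refl)) (inj₁ (same , half)) =
      same-token (sideLine-injective f f′ same half)
    hits-injective {f , _} {e = inj₁ _} (inj₁ (refl , _)) (inj₂ (_ , inj₁ (same , _))) =
      ⊥-elim (proj₁ (sideLine-not-diagonal f) same)
    hits-injective {f , _} {e = inj₁ _} (inj₁ (refl , _)) (inj₂ (_ , inj₂ (same , _))) =
      ⊥-elim (proj₂ (sideLine-not-diagonal f) same)
    hits-injective {t′ = f′ , _} {inj₁ _} (inj₂ (_ , inj₁ (refl , _))) (inj₁ (same , _)) =
      ⊥-elim (proj₁ (sideLine-not-diagonal f′) (sym same))
    hits-injective {t′ = f′ , _} {inj₁ _} (inj₂ (_ , inj₂ (refl , _))) (inj₁ (same , _)) =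
      ⊥-elim (proj₂ (sideLine-not-diagonal f′) (sym same))
    hits-injective {f , z} {f′ , z′} {inj₁ _} (inj₂ (on , inj₁ (refl , refl))) (inj₂ (on′ , inj₁ (same , half))) =
      same-token (diagonal-meets-half-once f f′ on on′ half
        (diagonal≡⇒SameDiag {s = point f z} {t = point f′ z′} (diagL-injective same)))
    hits-injective {f , z} {f′ , z′} {inj₁ _} (inj₂ (on , inj₂ (refl , refl))) (inj₂ (on′ , inj₂ (same , half))) =
      same-token (antidiagonal-meets-half-once f f′ on on′ half (antiL-injective same))
    hits-injective {e = inj₁ _} (inj₂ (_ , inj₁ (refl , _))) (inj₂ (_ , inj₂ (() , _)))
    hits-injective {e = inj₁ _} (inj₂ (_ , inj₂ (refl , _))) (inj₂ (_ , inj₁ (() , _)))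

    sides : List Side
    sides = left ∷ right ∷ bottom ∷ top ∷ []

    sides-unique : Unique sides
    sides-unique = ((λ ()) ∷ (λ ()) ∷ (λ ()) ∷ []) ∷ ((λ ()) ∷ (λ ()) ∷ []) ∷ ((λ ()) ∷ []) ∷ [] ∷ []

    rectangle-bound : 2 * N ≤ length W + 2
    rectangle-bound = halve {N} {length W} (subst₂ _≤_ length-tokens length-targets
      (injective-relation⇒length≤ tokens-unique hit hits-injective))
      where
      tokens-unique : Unique (cartesianProduct sides (allFin N))
      tokens-unique = Unique.cartesianProduct⁺ sides-unique (Unique.allFin⁺ N)
      length-tokens : length (cartesianProduct sides (allFin N)) ≡ 4 * N
      length-tokens = trans (length-cartesianProduct sides (allFin N)) (cong (4 *_) (length-allFin {N}))
      length-targets : length targets ≡ length W * 2 + 4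
      length-targets = trans (length-++ (map inj₁ (cartesianProduct W bools)))
        (cong₂ _+_ (trans (length-map inj₁ (cartesianProduct W bools)) (length-cartesianProduct W bools))
                   (length-map (inj₂ {A = Line × Bool}) corners))
      halve : ∀ {n w} → 4 * n ≤ w * 2 + 4 → 2 * n ≤ w + 2
      halve {n} {w} = *-cancelˡ-≤ 2 ∘ subst₂ _≤_ (double n) (double′ w)
        where
        double : ∀ n → 4 * n ≡ 2 * (2 * n)
        double = solve-∀
        double′ : ∀ w → w * 2 + 4 ≡ 2 * (w + 2)
        double′ = solve-∀

  board-bound : 2 * N ≤ length W + 2 ⊎ N ≤ m Q
  board-bound with extrema (λ y → ¬? (rowOccupied? y)) | extrema (λ x → ¬? (colOccupied? x))
  ... | inj₁ no-free-row | _ =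
    inj₂ (surjective⇒≥ (proj₂ ∘ pos Q) (λ y → decidable-stable (rowOccupied? y) (no-free-row y)))
  ... | inj₂ _ | inj₁ no-free-col =
    inj₂ (surjective⇒≥ (proj₁ ∘ pos Q) (λ x → decidable-stable (colOccupied? x) (no-free-col x)))
  ... | inj₂ (u₁ , u₂ , u₁-free , u₂-free , rows) | inj₂ (v₁ , v₂ , v₁-free , v₂-free , cols) =
    inj₁ (Rectangle.rectangle-bound u₁ u₂ v₁ v₂ u₁-free u₂-free v₁-free v₂-free rows cols)

queen-count-bound : ∀ {N k} (Q : Queens N k) → Dominating Q → (∀ c → ColorConnected Q c) →
  2 * N ≤ 3 * m Q + k + 2
queen-count-bound {N} {k} Q dominating connected =
  [ from-lines , from-queens ]′ (Board.board-bound Q dominating W covers)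
  where
  open GreedyCover _≟ᴸ_ (Edge Q) (color Q) (linesThrough ∘ pos Q) (λ _ → ≤-refl)
    (λ uv → common-line (edge-on-common-line {Q = Q} uv))
    (λ i j same → Star.map (proj₂ ∘ proj₂) (connected (color Q j) i j same refl))
  W = proj₁ lines-cover
  covers = proj₁ (proj₂ lines-cover)
  W≤ = proj₂ (proj₂ lines-cover)
  from-lines : 2 * N ≤ length W + 2 → 2 * N ≤ 3 * m Q + k + 2
  from-lines 2N≤W+2 = ≤-trans 2N≤W+2 (+-monoˡ-≤ 2 W≤)
  from-queens : N ≤ m Q → 2 * N ≤ 3 * m Q + k + 2
  from-queens N≤m = begin
    2 * N           ≤⟨ *-monoʳ-≤ 2 N≤m ⟩
    2 * m Q         ≤⟨ *-monoˡ-≤ (m Q) (n≤1+n 2) ⟩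
    3 * m Q         ≤⟨ m≤m+n (3 * m Q) k ⟩
    3 * m Q + k     ≤⟨ m≤m+n (3 * m Q + k) 2 ⟩
    3 * m Q + k + 2 ∎
    where open ≤-Reasoning

⌈/3⌉-≤ : ∀ {n m} → n ≤ 3 * m → ⌈ n /3⌉ ≤ m
⌈/3⌉-≤ {n} {m} n≤3m = s≤s⁻¹ (m<n*o⇒m/o<n (begin-strict
  n + 2           <⟨ s≤s (+-monoˡ-≤ 2 n≤3m) ⟩
  suc (3 * m + 2) ≡⟨ regroup m ⟩
  suc m * 3       ∎))
  where
  open ≤-Reasoning
  regroup : ∀ m → suc (3 * m + 2) ≡ suc m * 3
  regroup = solve-∀

mainTheorem3 : (N k : ℕ) → 1 ≤ N → 1 ≤ k → (Q : Queens N k) →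
    DistinctSquares Q → Dominating Q → (∀ (c : Fin k) → ColorConnected Q c) →
    ⌈ 2 * N ∸ k ∸ 2 /3⌉ ≤ m Q
mainTheorem3 N k _ _ Q _ dominating connected =
  ⌈/3⌉-≤ (m≤n+o⇒m∸n≤o (2 * N ∸ k) 2 (m≤n+o⇒m∸n≤o (2 * N) k 2N≤k+2+3m))
  where
  rearrange : ∀ m k → 3 * m + k + 2 ≡ k + (2 + 3 * m)
  rearrange = solve-∀
  2N≤k+2+3m : 2 * N ≤ k + (2 + 3 * m Q)
  2N≤k+2+3m = subst (2 * N ≤_) (rearrange (m Q) k) (queen-count-bound Q dominating connected)
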